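{- Let $\pi,\sigma$ be permutations such that $\mathrm{psb}(\pi)=\sigma$. If $m$ is a left-to-right maximum of $\pi$, then $m$ is a left-to-right maximum of $\sigma$ as well.
   Context: An entry $\pi_i$ of $\pi=\pi_1\cdots\pi_n$ is a left-to-right maximum if $\pi_i=\max\{\pi_j:j\le i\}$. The algorithm PSB processes $\pi$ from left to right with one pop stack $S$ (initially empty; PUSH puts an element on top, POP removes all elements appending them to the output from top to bottom) and an initially empty output: for $i=1,\dots,n$, if $S$ is empty or $\pi_i=\mathrm{TOP}(S)-1$ (where $\mathrm{TOP}(S)$ is the top element of $S$), push $\pi_i$; else if $\pi_i<\mathrm{TOP}(S)-1$, append $\pi_i$ directly to the output (bypass); otherwise pop $S$ and then push $\pi_i$. After all entries are processed, pop $S$. The output is $\mathrm{psb}(\pi)$. -}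

module Defs where

open import Data.Nat using (ℕ; zero; suc; _≤_; _<ᵇ_; _≡ᵇ_)
open import Data.Bool using (Bool; true; false; if_then_else_)
open import Data.List using (List; []; _∷_; _++_; map; upTo)
open import Data.List.Relation.Unary.All using (All)
open import Data.List.Relation.Binary.Permutation.Propositional using (_↭_)
open import Data.Product using (Σ; ∃₂; _×_; _,_)
open import Relation.Binary.PropositionalEquality using (_≡_)

IsPerm : ℕ → List ℕ → Set
IsPerm n π = π ↭ map suc (upTo n)

-- PSB state: (stack , output so far).  The stack is a list whose head is TOP(S).
-- POP appends all stack elements to the output from top to bottom,
-- i.e. output ++ stack (as a list read from the head).

psbStep : List ℕ × List ℕ → ℕ → List ℕ × List ℕ
psbStep ([] , out) x = (x ∷ [] , out)
psbStep (t ∷ s , out) x =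
  if t ≡ᵇ suc x
  then (x ∷ t ∷ s , out)
  else if suc x <ᵇ t
  then (t ∷ s , out ++ x ∷ [])
  else (x ∷ [] , out ++ t ∷ s)

psbRun : List ℕ × List ℕ → List ℕ → List ℕ × List ℕ
psbRun st [] = st
psbRun st (x ∷ xs) = psbRun (psbStep st x) xs

psb : List ℕ → List ℕ
psb π with psbRun ([] , []) π
... | (s , out) = out ++ s

IsLRMax : ℕ → List ℕ → Set
IsLRMax m π = ∃₂ λ (xs ys : List ℕ) → (π ≡ xs ++ m ∷ ys) × All (_≤ m) xs

{-# OPTIONS --safe #-}
-- Before m arrives every entry read is ≤ m, so when m arrives the top of the
-- stack is ≤ m; this forces a pop, and m is pushed onto the empty stack.  While m
-- stays at the bottom of the stack, every entry pushed or bypassed is smaller than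
-- the current top, hence ≤ m.  So whenever m reaches the output (at a later pop
-- or at the final pop) it is preceded only by entries ≤ m, and afterwards the
-- output only grows at its end.
module Submission where

open import Defs
open import Data.Nat using (ℕ; suc; _≤_; _<_; _≡ᵇ_; _<ᵇ_)
open import Data.Nat.Properties
  using (≡ᵇ⇒≡; ≡⇒≡ᵇ; <ᵇ-reflects-<; ≤-refl; <⇒≤; <-≤-trans; ≤⇒≯; 1+n≰n)
open import Data.Bool using (true; false)
open import Data.Unit using (tt)
open import Data.List using (List; []; _∷_; _++_)
open import Data.List.Properties using (++-assoc)
open import Data.List.Relation.Unary.All using (All; []; _∷_; universal)
open import Data.List.Relation.Unary.All.Properties using (++⁺)
open import Data.Product using (_×_; _,_)
open import Relation.Nullary.Negation using (contradiction)
open import Relation.Nullary.Reflects using (Reflects; ofʸ; ofⁿ; fromEquivalence)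
open import Relation.Binary.PropositionalEquality using (_≡_; refl; sym; trans; cong; subst)

State : Set
State = List ℕ × List ℕ

flush : State → List ℕ
flush (s , out) = out ++ s

psb≡flush-psbRun : ∀ π → psb π ≡ flush (psbRun ([] , []) π)
psb≡flush-psbRun π with psbRun ([] , []) π
... | (s , out) = refl

psbRun-++ : ∀ st xs ys → psbRun st (xs ++ ys) ≡ psbRun (psbRun st xs) ys
psbRun-++ st []       ys = refl
psbRun-++ st (x ∷ xs) ys = psbRun-++ (psbStep st x) xs ys

psbRun-preserves : ∀ {Q : ℕ → Set} (P : State → Set) →
                   (∀ {st x} → Q x → P st → P (psbStep st x)) →
                   ∀ {st xs} → All Q xs → P st → P (psbRun st xs)
psbRun-preserves P step []         p = p
psbRun-preserves P step (qx ∷ qxs) p = psbRun-preserves P step qxs (step qx p)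

data Step (x : ℕ) : State → State → Set where
  start  : ∀ {out}     → Step x ([] , out) (x ∷ [] , out)
  push   : ∀ {t s out} → t ≡ suc x → Step x (t ∷ s , out) (x ∷ t ∷ s , out)
  bypass : ∀ {t s out} → suc x < t → Step x (t ∷ s , out) (t ∷ s , out ++ x ∷ [])
  pop    : ∀ {t s out} → Step x (t ∷ s , out) (x ∷ [] , out ++ t ∷ s)

≡ᵇ-reflects-≡ : ∀ m n → Reflects (m ≡ n) (m ≡ᵇ n)
≡ᵇ-reflects-≡ m n = fromEquivalence (≡ᵇ⇒≡ m n) (≡⇒≡ᵇ m n)

psbStep-step : ∀ st x → Step x st (psbStep st x)
psbStep-step ([] , out) x = start
psbStep-step (t ∷ s , out) x with t ≡ᵇ suc x | ≡ᵇ-reflects-≡ t (suc x)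
... | true  | ofʸ t≡1+x = push t≡1+x
... | false | ofⁿ _ with suc x <ᵇ t | <ᵇ-reflects-< (suc x) t
...   | true  | ofʸ 1+x<t = bypass 1+x<t
...   | false | ofⁿ _     = pop

IsLRMax-++ˡ : ∀ {m} out {s} → All (_≤ m) out → IsLRMax m s → IsLRMax m (out ++ s)
IsLRMax-++ˡ {m} out out≤m (xs , ys , refl , xs≤m) =
  out ++ xs , ys , sym (++-assoc out xs (m ∷ ys)) , ++⁺ out≤m xs≤m

IsLRMax-++ʳ : ∀ {m} {out} k → IsLRMax m out → IsLRMax m (out ++ k)
IsLRMax-++ʳ {m} k (xs , ys , refl , xs≤m) = xs , ys ++ k , ++-assoc xs (m ∷ ys) k , xs≤m

Bounded : ℕ → State → Set
Bounded m (s , out) = All (_≤ m) s × All (_≤ m) out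

Step-bounded : ∀ {m x st st′} → x ≤ m → Step x st st′ → Bounded m st → Bounded m st′
Step-bounded x≤m start      (_ , out≤m)     = x≤m ∷ [] , out≤m
Step-bounded x≤m (push _)   (s≤m , out≤m)   = x≤m ∷ s≤m , out≤m
Step-bounded x≤m (bypass _) (s≤m , out≤m)   = s≤m , ++⁺ out≤m (x≤m ∷ [])
Step-bounded x≤m pop        (t∷s≤m , out≤m) = x≤m ∷ [] , ++⁺ out≤m t∷s≤m

data Rooted (m : ℕ) : List ℕ → Set where
  root : Rooted m (m ∷ [])
  _◂_  : ∀ {x s} → x ≤ m → Rooted m s → Rooted m (x ∷ s)

Rooted-head≤ : ∀ {m t s} → Rooted m (t ∷ s) → t ≤ m
Rooted-head≤ root      = ≤-refl
Rooted-head≤ (t≤m ◂ _) = t≤m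

Rooted⇒IsLRMax : ∀ {m s} → Rooted m s → IsLRMax m s
Rooted⇒IsLRMax root = [] , [] , refl , []
Rooted⇒IsLRMax (x≤m ◂ r) with Rooted⇒IsLRMax r
... | xs , ys , refl , xs≤m = _ ∷ xs , ys , refl , x≤m ∷ xs≤m

data Phase (m : ℕ) : State → Set where
  pending : ∀ {s out} → Rooted m s → All (_≤ m) out → Phase m (s , out)
  emitted : ∀ {s out} → IsLRMax m out → Phase m (s , out)

Step-phase : ∀ {m x st st′} → Step x st st′ → Phase m st → Phase m st′
Step-phase start          (pending () _)
Step-phase (push t≡1+x)   (pending r out≤m) =
  pending (<⇒≤ (subst (_≤ _) t≡1+x (Rooted-head≤ r)) ◂ r) out≤m
Step-phase (bypass 1+x<t) (pending r out≤m) =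
  pending r (++⁺ out≤m (<⇒≤ (<⇒≤ (<-≤-trans 1+x<t (Rooted-head≤ r))) ∷ []))
Step-phase pop            (pending r out≤m) = emitted (IsLRMax-++ˡ _ out≤m (Rooted⇒IsLRMax r))
Step-phase start          (emitted p)       = emitted p
Step-phase (push _)       (emitted p)       = emitted p
Step-phase (bypass _)     (emitted p)       = emitted (IsLRMax-++ʳ _ p)
Step-phase pop            (emitted p)       = emitted (IsLRMax-++ʳ _ p)

Step-max : ∀ {m st st′} → Step m st st′ → Bounded m st → Phase m st′
Step-max start          (_ , out≤m)     = pending root out≤m
Step-max (push t≡1+m)   (t≤m ∷ _ , _)   = contradiction (subst (_≤ _) t≡1+m t≤m) 1+n≰n
Step-max (bypass 1+m<t) (t≤m ∷ _ , _)   = contradiction (<⇒≤ 1+m<t) (≤⇒≯ t≤m)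
Step-max pop            (t∷s≤m , out≤m) = pending root (++⁺ out≤m t∷s≤m)

Phase⇒IsLRMax-flush : ∀ {m st} → Phase m st → IsLRMax m (flush st)
Phase⇒IsLRMax-flush (pending r out≤m) = IsLRMax-++ˡ _ out≤m (Rooted⇒IsLRMax r)
Phase⇒IsLRMax-flush (emitted p)       = IsLRMax-++ʳ _ p

mainTheorem15 : (n : ℕ) (π σ : List ℕ) (m : ℕ) →
    IsPerm n π → psb π ≡ σ → IsLRMax m π → IsLRMax m σ
mainTheorem15 _ _ _ m _ refl (xs , ys , refl , xs≤m) =
  subst (IsLRMax m) (sym psb≡flush) (Phase⇒IsLRMax-flush after-m)
  where
  before-m : State
  before-m = psbRun ([] , []) xs

  psb≡flush : psb (xs ++ m ∷ ys) ≡ flush (psbRun (psbStep before-m m) ys)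
  psb≡flush = trans (psb≡flush-psbRun (xs ++ m ∷ ys)) (cong flush (psbRun-++ ([] , []) xs (m ∷ ys)))

  bounded : Bounded m before-m
  bounded = psbRun-preserves (Bounded m) (λ x≤m → Step-bounded x≤m (psbStep-step _ _)) xs≤m ([] , [])

  after-m : Phase m (psbRun (psbStep before-m m) ys)
  after-m = psbRun-preserves (Phase m) (λ _ → Step-phase (psbStep-step _ _)) (universal (λ _ → tt) ys)
              (Step-max (psbStep-step before-m m) bounded)
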